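{- Let $\mathcal{H}$ be a family of (2-uniform) multigraphs and let $f$ be a graph simplification such that $f(H)$ is a complete graph for every $H\in\mathcal{H}$. Let $G$ be a multigraph, let $I\subseteq V(G)$ be an independent set in $f(G)$, and let $G'=C_I(G)$. Then $\operatorname{ex}(G',\mathcal{H})\leq\operatorname{ex}(G,\mathcal{H})$ (where loops of $G'$, if any, may be used in subgraphs when computing $\operatorname{ex}(G',\mathcal{H})$).
   Context: Multigraphs are finite and may have parallel edges (and loops where they arise). $\operatorname{ex}(G,\mathcal{H})$ is the maximum number of edges (with multiplicity) of a subgraph of $G$ containing no copy of any member of $\mathcal{H}$. Contraction: for a multigraph $G$ and $I\subseteq V(G)$, $C_I(G)$ is the multigraph with vertex set $(V(G)\cup\{z\})\setminus I$ for a new vertex $z$, whose edge multiset is $\{C_I(e): e\in E(G)\}$, where $C_I(e)=zz$ (a loop) if both ends of $e$ lie in $I$, $C_I(e)=zx$ if $e=ux$ with $u\in I$, $x\notin I$, and $C_I(e)=e$ otherwise; thus $C_I$ is a bijection of edge multisets. A graph simplification is a function $f$ from finite multigraphs to finite simple graphs such that $V(f(G))=V(G)$ for every $G$, and whenever $H$ is a subgraph of $G$, $f(H)$ is a subgraph of $f(G)$; $f$ is understood to be isomorphism-invariant (an isomorphism $H\to H'$ is also an isomorphism $f(H)\to f(H')$). Examples: the underlying simple graph; joining two vertices iff they lie in the same connected component. -}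

module Defs where

open import Data.Nat using (ℕ; zero; suc; _≤_)
open import Data.Fin using (Fin; zero; suc)
open import Data.Fin.Subset using (Subset; _∈_)
open import Data.Vec using (Vec; []; _∷_)
open import Data.Bool using (Bool; true; false)
open import Data.Maybe using (Maybe; just; nothing; maybe)
import Data.Maybe as Maybe
open import Data.Product using (Σ; _×_; _,_; proj₁; proj₂)
import Data.Product as Prod
open import Data.Sum using (_⊎_)
open import Relation.Binary.PropositionalEquality using (_≡_; _≢_)
open import Relation.Nullary using (¬_)
open import Function.Definitions using (Injective)

-- A finite multigraph: vertices Fin n, edges Fin m (so parallel edges are
-- distinct edge indices); each edge has two (unordered) ends; loops allowed.
record Multigraph : Set where
  field
    n    : ℕ
    m    : ℕ
    ends : Fin m → Fin n × Fin n
open Multigraph public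

SameEnds : {A : Set} → A × A → A × A → Set
SameEnds (a , b) (c , d) = (a ≡ c × b ≡ d) ⊎ (a ≡ d × b ≡ c)

-- An embedding of H into G (i.e. H is isomorphic to a subgraph of G):
-- injective on vertices and on edges, preserving incidence.
record Copy (H G : Multigraph) : Set where
  field
    φ     : Fin (n H) → Fin (n G)
    φ-inj : Injective _≡_ _≡_ φ
    ψ     : Fin (m H) → Fin (m G)
    ψ-inj : Injective _≡_ _≡_ ψ
    inc   : ∀ e → SameEnds (ends G (ψ e)) (Prod.map φ φ (ends H e))
open Copy public

Free : (ℋ : Multigraph → Set) → Multigraph → Set
Free ℋ S = ∀ H → ℋ H → ¬ Copy H S

-- ex(G₁,ℋ) ≤ ex(G₂,ℋ), unfolded: every ℋ-free subgraph of G₁ is matched in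
-- number of edges by some ℋ-free subgraph of G₂.
ExLe : (ℋ : Multigraph → Set) → Multigraph → Multigraph → Set
ExLe ℋ G₁ G₂ =
  (S : Multigraph) → Copy S G₁ → Free ℋ S →
  Σ Multigraph λ S₂ → Copy S₂ G₂ × Free ℋ S₂ × m S ≤ m S₂

-- Graph simplification: a simple graph f(G) on V(G) for each multigraph G
-- (Bool adjacency, symmetric, irreflexive), monotone under subgraphs and
-- isomorphism-invariant; both combined as: every embedding H → G maps
-- edges of f(H) to edges of f(G).
record Simplification : Set where
  field
    adj    : (G : Multigraph) → Fin (n G) → Fin (n G) → Bool
    sym    : ∀ G u v → adj G u v ≡ adj G v u
    irrefl : ∀ G v → adj G v v ≡ false
    mono   : ∀ H G (c : Copy H G) u v →
             adj H u v ≡ true → adj G (φ c u) (φ c v) ≡ true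
open Simplification public

Complete : Simplification → Multigraph → Set
Complete f H = ∀ u v → u ≢ v → adj f H u v ≡ true

IndependentIn : (f : Simplification) (G : Multigraph) → Subset (n G) → Set
IndependentIn f G I = ∀ u v → u ∈ I → v ∈ I → u ≢ v → adj f G u v ≡ false

-- Contraction.  Vertices outside I are relabelled order-preservingly as
-- Fin (keep I); the new vertex z is `zero` of Fin (suc (keep I)).
keep : ∀ {k} → Subset k → ℕ
keep []            = zero
keep (true  ∷ p)   = keep p
keep (false ∷ p)   = suc (keep p)

squash : ∀ {k} (p : Subset k) → Fin k → Maybe (Fin (keep p))
squash (true  ∷ p) zero    = nothing
squash (false ∷ p) zero    = just zero
squash (true  ∷ p) (suc v) = squash p v
squash (false ∷ p) (suc v) = Maybe.map suc (squash p v)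

cmap : ∀ {k} (p : Subset k) → Fin k → Fin (suc (keep p))
cmap p v = maybe suc zero (squash p v)

contract : (G : Multigraph) → Subset (n G) → Multigraph
contract G I = record
  { n    = suc (keep I)
  ; m    = m G
  ; ends = λ e → Prod.map (cmap I) (cmap I) (ends G e)
  }

-- Take an ℋ-free S ⊆ C_I(G) and let S₂ ⊆ G be its preimage: the same edges,
-- and the vertices of G that contraction sends into V(S).  A copy of some H ∈ ℋ in S₂ maps into S edge for edge;
-- its vertex map could only fail to be injective if two distinct vertices
-- of H landed in I, but f(H) is complete, so their images are adjacent in
-- f(S₂) ⊆ f(G), contradicting the independence of I.
module Submission where

open import Defs hiding (sym)
open import Data.Bool using (Bool; true; false; not)
open import Data.Fin using (Fin; zero; suc)
open import Data.Fin.Properties using (any?; _≟_; suc-injective)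
open import Data.Fin.Subset using (Subset; _∈_)
open import Data.Maybe using (just; nothing)
open import Data.Nat using (ℕ)
open import Data.Nat.Properties using (≤-refl)
open import Data.Product using (Σ; _×_; _,_; proj₁; proj₂)
import Data.Product as Prod
open import Data.Sum using (_⊎_; inj₁; inj₂)
open import Data.Vec using (Vec; _∷_; lookup; tabulate; here; there)
open import Data.Vec.Properties using (lookup∘tabulate)
open import Function using (_∘_)
open import Function.Definitions using (Injective)
open import Level using (Level; 0ℓ)
open import Relation.Binary.PropositionalEquality
  using (_≡_; _≢_; refl; sym; trans; cong; cong₂)
open import Relation.Nullary using (yes; no; does; contradiction)
open import Relation.Unary using (Pred; Decidable)

private
  variable
    k : ℕ
    ℓ : Level

-- `keep p` counts the FALSE entries of p; these are the kept positions.
fromKept : (p : Vec Bool k) → Fin (keep p) → Fin k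
fromKept (true  ∷ p) x       = suc (fromKept p x)
fromKept (false ∷ p) zero    = zero
fromKept (false ∷ p) (suc x) = suc (fromKept p x)

toKept : (p : Vec Bool k) (v : Fin k) → lookup p v ≡ false → Fin (keep p)
toKept (false ∷ p) zero    _  = zero
toKept (true  ∷ p) (suc v) pv = toKept p v pv
toKept (false ∷ p) (suc v) pv = suc (toKept p v pv)

fromKept-toKept : (p : Vec Bool k) (v : Fin k) (pv : lookup p v ≡ false) →
                  fromKept p (toKept p v pv) ≡ v
fromKept-toKept (false ∷ p) zero    _  = refl
fromKept-toKept (true  ∷ p) (suc v) pv = cong suc (fromKept-toKept p v pv)
fromKept-toKept (false ∷ p) (suc v) pv = cong suc (fromKept-toKept p v pv)

lookup-fromKept : (p : Vec Bool k) (x : Fin (keep p)) → lookup p (fromKept p x) ≡ false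
lookup-fromKept (true  ∷ p) x       = lookup-fromKept p x
lookup-fromKept (false ∷ p) zero    = refl
lookup-fromKept (false ∷ p) (suc x) = lookup-fromKept p x

fromKept-injective : (p : Vec Bool k) → Injective _≡_ _≡_ (fromKept p)
fromKept-injective (true  ∷ p) eq = fromKept-injective p (suc-injective eq)
fromKept-injective (false ∷ p) {zero}  {zero}  eq = refl
fromKept-injective (false ∷ p) {suc x} {suc y} eq =
  cong suc (fromKept-injective p (suc-injective eq))

squash-nothing⇒∈ : (p : Subset k) (v : Fin k) → squash p v ≡ nothing → v ∈ p
squash-nothing⇒∈ (true  ∷ p) zero    _  = here
squash-nothing⇒∈ (true  ∷ p) (suc v) eq = there (squash-nothing⇒∈ p v eq)
squash-nothing⇒∈ (false ∷ p) (suc v) eq with squash p v in eqv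
... | nothing = there (squash-nothing⇒∈ p v eqv)

squash-just⇒fromKept : (p : Subset k) (v : Fin k) {x : Fin (keep p)} →
                       squash p v ≡ just x → fromKept p x ≡ v
squash-just⇒fromKept (false ∷ p) zero    refl = refl
squash-just⇒fromKept (true  ∷ p) (suc v) eq   = cong suc (squash-just⇒fromKept p v eq)
squash-just⇒fromKept (false ∷ p) (suc v) eq with squash p v in eqv
squash-just⇒fromKept (false ∷ p) (suc v) refl | just y =
  cong suc (squash-just⇒fromKept p v eqv)

cmap-identifies-only-members : (p : Subset k) (v w : Fin k) → cmap p v ≡ cmap p w →
                               v ≡ w ⊎ (v ∈ p × w ∈ p)
cmap-identifies-only-members p v w eq with squash p v in eqv | squash p w in eqw
cmap-identifies-only-members p v w eq   | nothing | nothing =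
  inj₂ (squash-nothing⇒∈ p v eqv , squash-nothing⇒∈ p w eqw)
cmap-identifies-only-members p v w refl | just x  | just .x =
  inj₁ (trans (sym (squash-just⇒fromKept p v eqv)) (squash-just⇒fromKept p w eqw))

dropUnless : {P : Pred (Fin k) ℓ} → Decidable P → Vec Bool k
dropUnless P? = tabulate (not ∘ does ∘ P?)

dropUnless-false⇒ : {P : Pred (Fin k) ℓ} (P? : Decidable P) (v : Fin k) →
                    lookup (dropUnless P?) v ≡ false → P v
dropUnless-false⇒ P? v eq with P? v | trans (sym (lookup∘tabulate (not ∘ does ∘ P?) v)) eq
... | yes Pv | _ = Pv

⇒dropUnless-false : {P : Pred (Fin k) ℓ} (P? : Decidable P) (v : Fin k) →
                    P v → lookup (dropUnless P?) v ≡ false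
⇒dropUnless-false P? v Pv rewrite lookup∘tabulate (not ∘ does ∘ P?) v with P? v
... | yes _  = refl
... | no ¬Pv = contradiction Pv ¬Pv

module _ {A : Set} where

  SameEnds-sym : {x y : A × A} → SameEnds x y → SameEnds y x
  SameEnds-sym (inj₁ (p , q)) = inj₁ (sym p , sym q)
  SameEnds-sym (inj₂ (p , q)) = inj₂ (sym q , sym p)

  SameEnds-trans : {x y z : A × A} → SameEnds x y → SameEnds y z → SameEnds x z
  SameEnds-trans (inj₁ (p , q)) (inj₁ (r , s)) = inj₁ (trans p r , trans q s)
  SameEnds-trans (inj₁ (p , q)) (inj₂ (r , s)) = inj₂ (trans p r , trans q s)
  SameEnds-trans (inj₂ (p , q)) (inj₁ (r , s)) = inj₂ (trans p s , trans q r)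
  SameEnds-trans (inj₂ (p , q)) (inj₂ (r , s)) = inj₁ (trans p s , trans q r)

  SameEnds-respʳ-≡ : {x y z : A × A} → SameEnds x y → y ≡ z → SameEnds x z
  SameEnds-respʳ-≡ s refl = s

  module _ {B : Set} (g : A → B) where

    SameEnds-map : {x y : A × A} → SameEnds x y → SameEnds (Prod.map g g x) (Prod.map g g y)
    SameEnds-map (inj₁ (p , q)) = inj₁ (cong g p , cong g q)
    SameEnds-map (inj₂ (p , q)) = inj₂ (cong g p , cong g q)

    SameEnds-cancel : Injective _≡_ _≡_ g → {x y : A × A} →
                      SameEnds (Prod.map g g x) (Prod.map g g y) → SameEnds x y
    SameEnds-cancel g-inj (inj₁ (p , q)) = inj₁ (g-inj p , g-inj q)
    SameEnds-cancel g-inj (inj₂ (p , q)) = inj₂ (g-inj p , g-inj q)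

    SameEnds-image : {a b : B} {x : A × A} → SameEnds (a , b) (Prod.map g g x) →
                     (Σ A λ s → g s ≡ a) × (Σ A λ s → g s ≡ b)
    SameEnds-image (inj₁ (p , q)) = (_ , sym p) , (_ , sym q)
    SameEnds-image (inj₂ (p , q)) = (_ , sym p) , (_ , sym q)

record Hom (H G : Multigraph) : Set where
  field
    vmap : Fin (n H) → Fin (n G)
    emap : Fin (m H) → Fin (m G)
    hinc : ∀ e → SameEnds (ends G (emap e)) (Prod.map vmap vmap (ends H e))
open Hom

toHom : {H G : Multigraph} → Copy H G → Hom H G
toHom c = record { vmap = φ c ; emap = ψ c ; hinc = inc c }

_∘ʰ_ : {H S G : Multigraph} → Hom S G → Hom H S → Hom H G
g ∘ʰ h = record
  { vmap = vmap g ∘ vmap h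
  ; emap = emap g ∘ emap h
  ; hinc = λ e → SameEnds-trans (hinc g (emap h e)) (SameEnds-map (vmap g) (hinc h e))
  }

_∘ᶜ_ : {H S G : Multigraph} → Copy S G → Copy H S → Copy H G
c ∘ᶜ d = record
  { φ     = φ c ∘ φ d
  ; φ-inj = φ-inj d ∘ φ-inj c
  ; ψ     = ψ c ∘ ψ d
  ; ψ-inj = ψ-inj d ∘ ψ-inj c
  ; inc   = hinc (toHom c ∘ʰ toHom d)
  }

contraction : (G : Multigraph) (I : Subset (n G)) → Hom G (contract G I)
contraction G I = record { vmap = cmap I ; emap = λ e → e ; hinc = λ _ → inj₁ (refl , refl) }

-- Incidence in S is recovered from incidence in G since φ c is injective.
factor-through-copy : {H S G : Multigraph} (h : Hom H G) (c : Copy S G)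
  (φ′ : Fin (n H) → Fin (n S)) (ψ′ : Fin (m H) → Fin (m S)) →
  (∀ u → φ c (φ′ u) ≡ vmap h u) → (∀ e → ψ c (ψ′ e) ≡ emap h e) →
  ∀ e → SameEnds (ends S (ψ′ e)) (Prod.map φ′ φ′ (ends H e))
factor-through-copy {H} {S} {G} h c φ′ ψ′ φ-factors ψ-factors e =
  SameEnds-cancel (φ c) (φ-inj c) (SameEnds-respʳ-≡ viaG (cong₂ _,_ (sym (φ-factors _)) (sym (φ-factors _))))
  where
  viaG : SameEnds (Prod.map (φ c) (φ c) (ends S (ψ′ e))) (Prod.map (vmap h) (vmap h) (ends H e))
  viaG = SameEnds-trans (SameEnds-respʳ-≡ (SameEnds-sym (inc c (ψ′ e))) (cong (ends G) (ψ-factors e)))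
                        (hinc h e)

-- The preimage of a copy of S under h : G → G', given an injective lift of
-- the edges of S to G: the lifted edges, on the vertices h sends into S.
module Preimage {G G′ S : Multigraph} (h : Hom G G′) (c : Copy S G′)
  (lift : Fin (m S) → Fin (m G)) (lift-inj : Injective _≡_ _≡_ lift)
  (lift-ok : ∀ e → emap h (lift e) ≡ ψ c e) where

  HitsS : Pred (Fin (n G)) 0ℓ
  HitsS v = Σ (Fin (n S)) λ s → φ c s ≡ vmap h v

  hitsS? : Decidable HitsS
  hitsS? v = any? λ s → φ c s ≟ vmap h v

  dropped : Vec Bool (n G)
  dropped = dropUnless hitsS?

  restrict : (v : Fin (n G)) → HitsS v → Fin (keep dropped)
  restrict v hits = toKept dropped v (⇒dropUnless-false hitsS? v hits)

  lift-ends-hit-S : ∀ e → HitsS (proj₁ (ends G (lift e))) × HitsS (proj₂ (ends G (lift e)))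
  lift-ends-hit-S e = SameEnds-image (φ c)
    (SameEnds-trans (SameEnds-respʳ-≡ (SameEnds-sym (hinc h (lift e))) (cong (ends G′) (lift-ok e)))
                    (inc c e))

  preimage : Multigraph
  preimage = record
    { n    = keep dropped
    ; m    = m S
    ; ends = λ e → restrict _ (proj₁ (lift-ends-hit-S e)) , restrict _ (proj₂ (lift-ends-hit-S e))
    }

  preimage-copy : Copy preimage G
  preimage-copy = record
    { φ     = fromKept dropped
    ; φ-inj = fromKept-injective dropped
    ; ψ     = lift
    ; ψ-inj = lift-inj
    ; inc   = λ _ → inj₁ (sym (fromKept-toKept dropped _ _) , sym (fromKept-toKept dropped _ _))
    }

  preimage-hits-S : ∀ x → HitsS (fromKept dropped x)
  preimage-hits-S x = dropUnless-false⇒ hitsS? (fromKept dropped x) (lookup-fromKept dropped x)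

  copy-into-S : (f : Simplification) →
    (∀ u v → vmap h u ≡ vmap h v → u ≢ v → adj f G u v ≡ false) →
    {H : Multigraph} → Complete f H → Copy H preimage → Copy H S
  copy-into-S f h-merges-only-nonadjacent {H} complete d = record
    { φ     = φ′
    ; φ-inj = φ′-inj
    ; ψ     = ψ d
    ; ψ-inj = ψ-inj d
    ; inc   = factor-through-copy (h ∘ʰ toHom embedded) c φ′ (ψ d) φ′-factors (sym ∘ lift-ok ∘ ψ d)
    }
    where
    embedded : Copy H G
    embedded = preimage-copy ∘ᶜ d

    φ′ : Fin (n H) → Fin (n S)
    φ′ u = proj₁ (preimage-hits-S (φ d u))

    φ′-factors : ∀ u → φ c (φ′ u) ≡ vmap h (φ embedded u)
    φ′-factors u = proj₂ (preimage-hits-S (φ d u))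

    φ′-inj : Injective _≡_ _≡_ φ′
    φ′-inj {u} {u′} eq with u ≟ u′
    ... | yes u≡u′ = u≡u′
    ... | no  u≢u′ = contradiction (trans (sym adjacent) nonadjacent) λ ()
      where
      adjacent : adj f G (φ embedded u) (φ embedded u′) ≡ true
      adjacent = mono f H G embedded u u′ (complete u u′ u≢u′)
      nonadjacent : adj f G (φ embedded u) (φ embedded u′) ≡ false
      nonadjacent = h-merges-only-nonadjacent _ _
        (trans (sym (φ′-factors u)) (trans (cong (φ c) eq) (φ′-factors u′)))
        (u≢u′ ∘ φ-inj embedded)

contraction-merges-only-nonadjacent : (f : Simplification) (G : Multigraph) (I : Subset (n G)) →
  IndependentIn f G I →
  ∀ u v → cmap I u ≡ cmap I v → u ≢ v → adj f G u v ≡ false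
contraction-merges-only-nonadjacent f G I independent u v eq u≢v
  with cmap-identifies-only-members I u v eq
... | inj₁ u≡v         = contradiction u≡v u≢v
... | inj₂ (u∈I , v∈I) = independent u v u∈I v∈I u≢v

lemma3p3 : (ℋ : Multigraph → Set) (f : Simplification) →
           (∀ H → ℋ H → Complete f H) →
           (G : Multigraph) (I : Subset (n G)) → IndependentIn f G I →
           ExLe ℋ (contract G I) G
lemma3p3 ℋ f complete G I independent S c S-free =
  preimage , preimage-copy , preimage-free , ≤-refl
  where
  open Preimage (contraction G I) c (ψ c) (ψ-inj c) (λ _ → refl)
  preimage-free : Free ℋ preimage
  preimage-free H H∈ℋ d = S-free H H∈ℋ
    (copy-into-S f (contraction-merges-only-nonadjacent f G I independent) (complete H H∈ℋ) d)
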